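{- Let $G$ be the undirected graph whose vertex set is the set of positive integers, in which distinct vertices $n$ and $m$ are joined by an edge if $m$ can be obtained from $n$ by one Choix de Bruxelles operation. Then $G$ has exactly two connected components: one consists of all positive integers whose decimal expansion does not end in $0$ or $5$, and the other consists of all positive integers whose decimal expansion ends in $0$ or $5$.
   Context: The Choix de Bruxelles operation: given a positive integer $n$ with decimal expansion $d_1 d_2 \ldots d_k$, choose indices $1 \le p \le q \le k$ with $d_p \neq 0$, let $s$ be the number with decimal representation $d_p d_{p+1}\ldots d_q$, and replace this substring in situ by the decimal expansion of $2s$, or, if $s$ is even, by the decimal expansion of $s/2$. One may also leave $n$ unchanged (empty substring). The operation is symmetric: if $n$ can be changed to $m$ then $m$ can be changed to $n$. -}

module Defs where

open import Data.Nat using (ℕ; zero; suc; _+_; _*_; _<_; _%_)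
open import Data.List using (List; []; _∷_; _++_; foldl)
open import Data.List.Relation.Unary.All using (All)
open import Data.Product using (Σ; _×_; ∃-syntax)
open import Data.Sum using (_⊎_)
open import Data.Empty using (⊥)
open import Relation.Binary.PropositionalEquality using (_≡_; _≢_)
open import Relation.Binary.Construct.Closure.ReflexiveTransitive using (Star)

fromDigits : List ℕ → ℕ
fromDigits = foldl (λ acc d → 10 * acc + d) 0

LeadingNonzero : List ℕ → Set
LeadingNonzero []      = ⊥
LeadingNonzero (d ∷ _) = d ≢ 0

IsDecExp : List ℕ → ℕ → Set
IsDecExp ds n = All (_< 10) ds × LeadingNonzero ds × fromDigits ds ≡ n

data BrStep (n m : ℕ) : Set where
  double : (L S R es : List ℕ) →
           IsDecExp (L ++ S ++ R) n → LeadingNonzero S →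
           IsDecExp es (2 * fromDigits S) →
           fromDigits (L ++ es ++ R) ≡ m → BrStep n m
  halve  : (L S R es : List ℕ) (t : ℕ) →
           IsDecExp (L ++ S ++ R) n → LeadingNonzero S →
           fromDigits S ≡ 2 * t → IsDecExp es t →
           fromDigits (L ++ es ++ R) ≡ m → BrStep n m

Edge : ℕ → ℕ → Set
Edge n m = 0 < n × 0 < m × n ≢ m × (BrStep n m ⊎ BrStep m n)

Connected : ℕ → ℕ → Set
Connected = Star Edge

EndsIn0or5 : ℕ → Set
EndsIn0or5 n = n % 10 ≡ 0 ⊎ n % 10 ≡ 5

-- A move replaces a nonempty block s of the expansion by 2s or s/2.  Since 5 divides 10 and is
-- prime to 2, divisibility by 5 of a number is decided by any nonempty final segment of its
-- expansion, and divisibility by 5 of the replaced block survives doubling and halving; so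
-- ending in 0 or 5 is constant along paths.  Conversely every n is joined to 1 or to 5: writing
-- n = 10q + d, the moves of a path from q to c ∈ {1, 5} still apply with d appended, giving a
-- path from n to 10c + d, and 1, ..., 9, 10, ..., 19, 50, ..., 59 are joined to 1 or 5 by
-- explicit paths, each step of which is found and certified by a search over all moves.

module Submission where

open import Defs
open import Data.Nat using (ℕ; zero; suc; _+_; _*_; _^_; _%_; _/_; _≤_; _<_; z≤n; s≤s; _<?_; _≟_; >-nonZero)
open import Data.Nat.Properties
  using (*-comm; +-comm; +-identityʳ; *-identityʳ; *-cancelˡ-≡; +-cancelʳ-≡; m≤m+n; ≤-refl; ≤-trans; <-≤-trans; ≤-pred; ≮⇒≥; ≤⇒≯; n≢0⇒n>0; 1+n≢0)
open import Data.Nat.DivMod using (m≡m%n+[m/n]*n; m%n<n; m/n<m; m≥n⇒m/n>0)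
open import Data.Nat.Divisibility using (_∣_; divides; _∣?_; ∣m∣n⇒∣m+n; ∣m+n∣m⇒∣n; ∣m⇒∣m*n; ∣n⇒∣m*n)
open import Data.Nat.Coprimality using (Coprime; coprime-divisor; coprime-+; 1-coprimeTo)
open import Data.Nat.Induction using (<-rec)
open import Data.Nat.Tactic.RingSolver using (solve-∀)
open import Data.List using (List; []; _∷_; _++_; _∷ʳ_; [_]; foldl; length; map; concatMap)
open import Data.List.Properties using (foldl-++; foldl-∷ʳ; ++-assoc; ++-identityʳ)
open import Data.List.Relation.Unary.All using ([]; _∷_)
open import Data.List.Relation.Unary.All.Properties using (∷ʳ⁺)
open import Data.Maybe using (Maybe; just; nothing; from-just)
import Data.Maybe as Maybe
open import Data.Product using (∃; ∃₂; _,_)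
open import Data.Sum using (_⊎_; inj₁; inj₂)
import Data.Sum as Sum
open import Data.Empty using (⊥-elim)
open import Function using (_∘_)
open import Function.Bundles using (_⇔_; mk⇔; Equivalence)
import Function.Properties.Equivalence as ⇔
open import Relation.Nullary using (yes; no; ¬?; contradiction)
open import Relation.Unary using (Decidable)
open import Relation.Binary using (Symmetric)
open import Relation.Binary.PropositionalEquality using (_≡_; _≢_; refl; sym; trans; cong; subst; subst₂; module ≡-Reasoning)
open import Relation.Binary.Construct.Closure.ReflexiveTransitive using (ε; _◅_; _◅◅_; gmap; fold; reverse)

fromDigits-∷ʳ : ∀ ds d → fromDigits (ds ∷ʳ d) ≡ 10 * fromDigits ds + d
fromDigits-∷ʳ ds d = foldl-∷ʳ _ 0 d ds

foldl-decimal : ∀ a ys → foldl (λ acc d → 10 * acc + d) a ys ≡ a * 10 ^ length ys + fromDigits ys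
foldl-decimal a [] = sym (trans (+-identityʳ (a * 1)) (*-identityʳ a))
foldl-decimal a (y ∷ ys) = begin
  foldl _ (10 * a + y) ys                       ≡⟨ foldl-decimal (10 * a + y) ys ⟩
  (10 * a + y) * 10 ^ length ys + fromDigits ys ≡⟨ regroup a y (10 ^ length ys) (fromDigits ys) ⟩
  a * 10 ^ length (y ∷ ys) + (y * 10 ^ length ys + fromDigits ys)
    ≡⟨ cong (a * 10 ^ length (y ∷ ys) +_) (sym (foldl-decimal y ys)) ⟩
  a * 10 ^ length (y ∷ ys) + fromDigits (y ∷ ys) ∎
  where
  open ≡-Reasoning
  regroup : ∀ a y p r → (10 * a + y) * p + r ≡ a * (10 * p) + (y * p + r)
  regroup = solve-∀

fromDigits-++ : ∀ xs ys → fromDigits (xs ++ ys) ≡ fromDigits xs * 10 ^ length ys + fromDigits ys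
fromDigits-++ xs ys = trans (foldl-++ _ 0 xs ys) (foldl-decimal (fromDigits xs) ys)

leadingNonzero? : Decidable LeadingNonzero
leadingNonzero? []      = no (λ ())
leadingNonzero? (d ∷ _) = ¬? (d ≟ 0)

LeadingNonzero⇒≢[] : ∀ {ds} → LeadingNonzero ds → ds ≢ []
LeadingNonzero⇒≢[] {_ ∷ _} _ ()

LeadingNonzero-++ : ∀ {xs} ys → LeadingNonzero xs → LeadingNonzero (xs ++ ys)
LeadingNonzero-++ {_ ∷ _} _ d≢0 = d≢0

foldl-decimal-≥ : ∀ a ys → a ≤ foldl (λ acc d → 10 * acc + d) a ys
foldl-decimal-≥ a [] = ≤-refl
foldl-decimal-≥ a (y ∷ ys) =
  ≤-trans (≤-trans (m≤m+n a (9 * a)) (m≤m+n (10 * a) y)) (foldl-decimal-≥ (10 * a + y) ys)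

fromDigits-pos : ∀ {ds} → LeadingNonzero ds → 0 < fromDigits ds
fromDigits-pos {d ∷ ds} d≢0 = <-≤-trans (n≢0⇒n>0 d≢0) (foldl-decimal-≥ d ds)

IsDecExp-∷ʳ : ∀ {ds n d} → d < 10 → IsDecExp ds n → IsDecExp (ds ∷ʳ d) (10 * n + d)
IsDecExp-∷ʳ {ds} {d = d} d<10 (ds<10 , lnz , refl) =
  ∷ʳ⁺ ds<10 d<10 , LeadingNonzero-++ [ d ] lnz , fromDigits-∷ʳ ds d

n≡10*[n/10]+n%10 : ∀ n → n ≡ 10 * (n / 10) + n % 10
n≡10*[n/10]+n%10 n =
  trans (m≡m%n+[m/n]*n n 10) (trans (+-comm (n % 10) _) (cong (_+ n % 10) (*-comm (n / 10) 10)))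

-- With fuel f ≥ n the recursion is structural; toDigits 0 = [].
digitsWithin : ℕ → ℕ → List ℕ
digitsWithin _       zero      = []
digitsWithin zero    (suc _)   = []
digitsWithin (suc f) n@(suc _) = digitsWithin f (n / 10) ∷ʳ n % 10

toDigits : ℕ → List ℕ
toDigits n = digitsWithin n n

IsDecExp-digitsWithin : ∀ f {n} → 0 < n → n ≤ f → IsDecExp (digitsWithin f n) n
IsDecExp-digitsWithin (suc f) {n@(suc _)} n>0 n≤1+f =
  subst (IsDecExp _) (sym (n≡10*[n/10]+n%10 n)) (expansion (n / 10) refl)
  where
  r<10 : n % 10 < 10
  r<10 = m%n<n n 10
  expansion : ∀ q → q ≡ n / 10 → IsDecExp (digitsWithin f q ∷ʳ n % 10) (10 * q + n % 10)
  expansion zero q≡ = r<10 ∷ [] , r≢0 , refl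
    where
    r≢0 : n % 10 ≢ 0
    r≢0 = 1+n≢0 ∘ trans (subst (λ q → n ≡ 10 * q + n % 10) (sym q≡) (n≡10*[n/10]+n%10 n))
  expansion q@(suc _) q≡ = IsDecExp-∷ʳ r<10 (IsDecExp-digitsWithin f (s≤s z≤n) q≤f)
    where
    q≤f : q ≤ f
    q≤f = ≤-pred (<-≤-trans (subst (_< n) (sym q≡) (m/n<m n 10 (s≤s (s≤s z≤n)))) n≤1+f)

IsDecExp-toDigits : ∀ {n} → 0 < n → IsDecExp (toDigits n) n
IsDecExp-toDigits n>0 = IsDecExp-digitsWithin _ n>0 ≤-refl

∣m⇒∣m+n⇔∣n : ∀ {d m n} → d ∣ m → d ∣ m + n ⇔ d ∣ n
∣m⇒∣m+n⇔∣n d∣m = mk⇔ (λ d∣m+n → ∣m+n∣m⇒∣n d∣m+n d∣m) (∣m∣n⇒∣m+n d∣m)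

module _ {k : ℕ} (k∣10 : k ∣ 10) where

  ∣-fromDigits-++ : ∀ xs y ys → k ∣ fromDigits (xs ++ y ∷ ys) ⇔ k ∣ fromDigits (y ∷ ys)
  ∣-fromDigits-++ xs y ys =
    subst (λ x → k ∣ x ⇔ k ∣ fromDigits (y ∷ ys)) (sym (fromDigits-++ xs (y ∷ ys)))
      (∣m⇒∣m+n⇔∣n {m = fromDigits xs * 10 ^ length (y ∷ ys)} (∣n⇒∣m*n (fromDigits xs) k∣10^suc))
    where
    k∣10^suc : k ∣ 10 ^ suc (length ys)
    k∣10^suc = ∣m⇒∣m*n (10 ^ length ys) k∣10

  ∣-fromDigits-infix : ∀ L {S E} R → S ≢ [] → E ≢ [] → (k ∣ fromDigits S ⇔ k ∣ fromDigits E) →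
                       k ∣ fromDigits (L ++ S ++ R) ⇔ k ∣ fromDigits (L ++ E ++ R)
  ∣-fromDigits-infix L {S} {E} (r ∷ R) _ _ _
    rewrite sym (++-assoc L S (r ∷ R)) | sym (++-assoc L E (r ∷ R)) =
    ⇔.trans (∣-fromDigits-++ (L ++ S) r R) (⇔.sym (∣-fromDigits-++ (L ++ E) r R))
  ∣-fromDigits-infix L {s ∷ S} {e ∷ E} [] _ _ S⇔E
    rewrite ++-identityʳ (s ∷ S) | ++-identityʳ (e ∷ E) =
    ⇔.trans (∣-fromDigits-++ L s S) (⇔.trans S⇔E (⇔.sym (∣-fromDigits-++ L e E)))
  ∣-fromDigits-infix _ {[]}    [] S≢[] _ _ = ⊥-elim (S≢[] refl)
  ∣-fromDigits-infix _ {_ ∷ _} {[]} [] _ E≢[] _ = ⊥-elim (E≢[] refl)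

  module _ (k⊥2 : Coprime k 2) where

    ∣2*n⇔∣n : ∀ {n} → k ∣ 2 * n ⇔ k ∣ n
    ∣2*n⇔∣n = mk⇔ (coprime-divisor k⊥2) (∣n⇒∣m*n 2)

    BrStep-pres-∣ : ∀ {n m} → BrStep n m → k ∣ n ⇔ k ∣ m
    BrStep-pres-∣ (double L S R es (_ , _ , refl) lnS (_ , lnE , E≡2S) refl) =
      ∣-fromDigits-infix L R (LeadingNonzero⇒≢[] lnS) (LeadingNonzero⇒≢[] lnE)
        (subst (λ e → k ∣ fromDigits S ⇔ k ∣ e) (sym E≡2S) (⇔.sym ∣2*n⇔∣n))
    BrStep-pres-∣ (halve L S R es t (_ , _ , refl) lnS S≡2t (_ , lnE , E≡t) refl) =
      ∣-fromDigits-infix L R (LeadingNonzero⇒≢[] lnS) (LeadingNonzero⇒≢[] lnE)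
        (subst₂ (λ s e → k ∣ s ⇔ k ∣ e) (sym S≡2t) (sym E≡t) ∣2*n⇔∣n)

    Edge-pres-∣ : ∀ {n m} → Edge n m → k ∣ n ⇔ k ∣ m
    Edge-pres-∣ (_ , _ , _ , inj₁ n↦m) = BrStep-pres-∣ n↦m
    Edge-pres-∣ (_ , _ , _ , inj₂ m↦n) = ⇔.sym (BrStep-pres-∣ m↦n)

    Connected-pres-∣ : ∀ {n m} → Connected n m → k ∣ n ⇔ k ∣ m
    Connected-pres-∣ = fold (λ n m → k ∣ n ⇔ k ∣ m) (λ e → ⇔.trans (Edge-pres-∣ e)) ⇔.refl

Connected-pres-5∣ : ∀ {n m} → Connected n m → 5 ∣ n ⇔ 5 ∣ m
Connected-pres-5∣ = Connected-pres-∣ (divides 2 refl) (coprime-+ (coprime-+ (1-coprimeTo 2)))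

++-∷ʳ-assoc : ∀ (L S R : List ℕ) d → (L ++ S ++ R) ∷ʳ d ≡ L ++ S ++ (R ∷ʳ d)
++-∷ʳ-assoc L S R d = trans (++-assoc L (S ++ R) [ d ]) (cong (L ++_) (++-assoc S R [ d ]))

fromDigits-infix-∷ʳ : ∀ L S R d → fromDigits (L ++ S ++ (R ∷ʳ d)) ≡ 10 * fromDigits (L ++ S ++ R) + d
fromDigits-infix-∷ʳ L S R d = trans (cong fromDigits (sym (++-∷ʳ-assoc L S R d))) (fromDigits-∷ʳ (L ++ S ++ R) d)

module _ {d : ℕ} (d<10 : d < 10) where

  IsDecExp-infix-∷ʳ : ∀ L S R {n} → IsDecExp (L ++ S ++ R) n → IsDecExp (L ++ S ++ (R ∷ʳ d)) (10 * n + d)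
  IsDecExp-infix-∷ʳ L S R n≅ = subst (λ ds → IsDecExp ds _) (++-∷ʳ-assoc L S R d) (IsDecExp-∷ʳ d<10 n≅)

  BrStep-∷ʳ : ∀ {n m} → BrStep n m → BrStep (10 * n + d) (10 * m + d)
  BrStep-∷ʳ (double L S R es n≅ lnS es≅ refl) =
    double L S (R ∷ʳ d) es (IsDecExp-infix-∷ʳ L S R n≅) lnS es≅ (fromDigits-infix-∷ʳ L es R d)
  BrStep-∷ʳ (halve L S R es t n≅ lnS S≡2t es≅ refl) =
    halve L S (R ∷ʳ d) es t (IsDecExp-infix-∷ʳ L S R n≅) lnS S≡2t es≅ (fromDigits-infix-∷ʳ L es R d)

  Edge-∷ʳ : ∀ {n m} → Edge n m → Edge (10 * n + d) (10 * m + d)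
  Edge-∷ʳ {n} {m} (n>0 , m>0 , n≢m , step) =
    pos n>0 , pos m>0 , n≢m ∘ cancel , Sum.map BrStep-∷ʳ BrStep-∷ʳ step
    where
    pos : ∀ {x} → 0 < x → 0 < 10 * x + d
    pos {suc _} _ = s≤s z≤n
    cancel : 10 * n + d ≡ 10 * m + d → n ≡ m
    cancel = *-cancelˡ-≡ n m 10 ∘ +-cancelʳ-≡ d (10 * n) (10 * m)

  Connected-∷ʳ : ∀ {n m} → Connected n m → Connected (10 * n + d) (10 * m + d)
  Connected-∷ʳ = gmap _ Edge-∷ʳ

Split : List ℕ → Set
Split ds = ∃₂ λ (L S : List ℕ) → ∃ λ R → L ++ S ++ R ≡ ds

prefixSplits : ∀ ds → List (∃₂ λ (S R : List ℕ) → S ++ R ≡ ds)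
prefixSplits []       = []
prefixSplits (d ∷ ds) = ([ d ] , ds , refl) ∷ map extend (prefixSplits ds)
  where
  extend : (∃₂ λ (S R : List ℕ) → S ++ R ≡ ds) → ∃₂ λ (S R : List ℕ) → S ++ R ≡ d ∷ ds
  extend (S , R , eq) = d ∷ S , R , cong (d ∷_) eq

splits : ∀ ds → List (Split ds)
splits []       = []
splits (d ∷ ds) = map leading (prefixSplits (d ∷ ds)) ++ map extend (splits ds)
  where
  leading : (∃₂ λ (S R : List ℕ) → S ++ R ≡ d ∷ ds) → Split (d ∷ ds)
  leading (S , R , eq) = [] , S , R , eq
  extend : Split ds → Split (d ∷ ds)
  extend (L , S , R , eq) = d ∷ L , S , R , cong (d ∷_) eq

module _ {n : ℕ} (L S R : List ℕ) (n≅ : IsDecExp (L ++ S ++ R) n) (lnS : LeadingNonzero S) where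

  doubling : ∃ (BrStep n)
  doubling = _ , double L S R _ n≅ lnS (IsDecExp-toDigits 2s>0) refl
    where
    2s>0 : 0 < 2 * fromDigits S
    2s>0 = <-≤-trans (fromDigits-pos lnS) (m≤m+n _ _)

  halving : List (∃ (BrStep n))
  halving with 2 ∣? fromDigits S
  ... | no  _ = []
  ... | yes (divides t S≡t*2) =
    [ _ , halve L S R _ t n≅ lnS (trans S≡t*2 (*-comm t 2)) (IsDecExp-toDigits t>0) refl ]
    where
    positive-half : ∀ t → 0 < t * 2 → 0 < t
    positive-half (suc _) _ = s≤s z≤n
    t>0 : 0 < t
    t>0 = positive-half t (subst (0 <_) S≡t*2 (fromDigits-pos lnS))

movesAt : ∀ {n ds} → IsDecExp ds n → Split ds → List (∃ (BrStep n))
movesAt n≅ (L , S , R , refl) with leadingNonzero? S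
... | no  _   = []
... | yes lnS = doubling L S R n≅ lnS ∷ halving L S R n≅ lnS

neighbours : ∀ n → List (∃ (BrStep n))
neighbours zero        = []
neighbours n@(suc _) = concatMap (movesAt (IsDecExp-toDigits (s≤s z≤n))) (splits (toDigits n))

witnessFor : ∀ {P : ℕ → Set} m → List (∃ P) → Maybe (P m)
witnessFor m []              = nothing
witnessFor {P} m ((k , p) ∷ kps) with k ≟ m
... | yes k≡m = just (subst P k≡m p)
... | no  _    = witnessFor m kps

findEdge : ∀ n m → Maybe (Edge n m)
findEdge zero      _         = nothing
findEdge (suc _)   zero      = nothing
findEdge n@(suc _) m@(suc _) with n ≟ m
... | yes _   = nothing
... | no  n≢m = Maybe.map (λ n↦m → s≤s z≤n , s≤s z≤n , n≢m , inj₁ n↦m) (witnessFor m (neighbours n))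

-- `from-just (walk n ks m)` type-checks only if each step along n, ks, m is a move.
walk : ∀ n → List ℕ → ∀ m → Maybe (Connected n m)
walk n []       m = Maybe.map (_◅ ε) (findEdge n m)
walk n (k ∷ ks) m = Maybe.zipWith _◅_ (findEdge n k) (walk k ks m)

rep : ℕ → ℕ
rep n with 5 ∣? n
... | yes _ = 5
... | no  _ = 1

rep-cases : ∀ n → rep n ≡ 1 ⊎ rep n ≡ 5
rep-cases n with 5 ∣? n
... | yes _ = inj₂ refl
... | no  _ = inj₁ refl

rep-cong : ∀ {n m} → (5 ∣ n ⇔ 5 ∣ m) → rep n ≡ rep m
rep-cong {n} {m} n⇔m with 5 ∣? n | 5 ∣? m
... | yes _   | yes _   = refl
... | no  _   | no  _   = refl
... | yes 5∣n | no  5∤m = contradiction (Equivalence.to n⇔m 5∣n) 5∤m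
... | no  5∤n | yes 5∣m = contradiction (Equivalence.from n⇔m 5∣m) 5∤n

16⇝1 : Connected 16 1
16⇝1 = from-just (walk 16 (8 ∷ 4 ∷ 2 ∷ []) 1)

160⇝5 : Connected 160 5
160⇝5 = from-just (walk 160 (80 ∷ 40 ∷ 20 ∷ 10 ∷ []) 5)

reach-single-digit : ∀ n → 0 < n → n < 10 → Connected n (rep n)
reach-single-digit 0 () _
reach-single-digit 1 _ _ = ε
reach-single-digit 2 _ _ = from-just (walk 2 [] 1)
reach-single-digit 3 _ _ = from-just (walk 3 (6 ∷ 12 ∷ 14 ∷ 28 ∷ 56 ∷ 112 ∷ []) 16) ◅◅ 16⇝1
reach-single-digit 4 _ _ = from-just (walk 4 (2 ∷ []) 1)
reach-single-digit 5 _ _ = ε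
reach-single-digit 6 _ _ = from-just (walk 6 (12 ∷ 14 ∷ 28 ∷ 56 ∷ 112 ∷ []) 16) ◅◅ 16⇝1
reach-single-digit 7 _ _ = from-just (walk 7 (14 ∷ 28 ∷ 56 ∷ 112 ∷ []) 16) ◅◅ 16⇝1
reach-single-digit 8 _ _ = from-just (walk 8 (4 ∷ 2 ∷ []) 1)
reach-single-digit 9 _ _ = from-just (walk 9 (18 ∷ 28 ∷ 56 ∷ 112 ∷ []) 16) ◅◅ 16⇝1
reach-single-digit (suc (suc (suc (suc (suc (suc (suc (suc (suc (suc _)))))))))) _ (s≤s (s≤s (s≤s (s≤s (s≤s (s≤s (s≤s (s≤s (s≤s (s≤s ()))))))))))

reach-1d : ∀ d → d < 10 → Connected (10 + d) (rep (10 + d))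
reach-1d 0 _ = from-just (walk 10 [] 5)
reach-1d 1 _ = from-just (walk 11 (12 ∷ 14 ∷ 28 ∷ 56 ∷ 112 ∷ []) 16) ◅◅ 16⇝1
reach-1d 2 _ = from-just (walk 12 (14 ∷ 28 ∷ 56 ∷ 112 ∷ []) 16) ◅◅ 16⇝1
reach-1d 3 _ = from-just (walk 13 [] 16) ◅◅ 16⇝1
reach-1d 4 _ = from-just (walk 14 (28 ∷ 56 ∷ 112 ∷ []) 16) ◅◅ 16⇝1
reach-1d 5 _ = from-just (walk 15 (110 ∷ 55 ∷ 510 ∷ 520 ∷ 260 ∷ []) 160) ◅◅ 160⇝5
reach-1d 6 _ = 16⇝1
reach-1d 7 _ = from-just (walk 17 (34 ∷ 32 ∷ []) 16) ◅◅ 16⇝1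
reach-1d 8 _ = from-just (walk 18 (28 ∷ 56 ∷ 112 ∷ []) 16) ◅◅ 16⇝1
reach-1d 9 _ = from-just (walk 19 (118 ∷ 114 ∷ 112 ∷ []) 16) ◅◅ 16⇝1
reach-1d (suc (suc (suc (suc (suc (suc (suc (suc (suc (suc _)))))))))) (s≤s (s≤s (s≤s (s≤s (s≤s (s≤s (s≤s (s≤s (s≤s (s≤s ()))))))))))

reach-5d : ∀ d → d < 10 → Connected (50 + d) (rep (50 + d))
reach-5d 0 _ = from-just (walk 50 (25 ∷ 45 ∷ 85 ∷ 170 ∷ 1140 ∷ 1120 ∷ []) 160) ◅◅ 160⇝5
reach-5d 1 _ = from-just (walk 51 (52 ∷ 26 ∷ []) 16) ◅◅ 16⇝1
reach-5d 2 _ = from-just (walk 52 (26 ∷ []) 16) ◅◅ 16⇝1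
reach-5d 3 _ = from-just (walk 53 (56 ∷ 112 ∷ []) 16) ◅◅ 16⇝1
reach-5d 4 _ = from-just (walk 54 (52 ∷ 26 ∷ []) 16) ◅◅ 16⇝1
reach-5d 5 _ = from-just (walk 55 (510 ∷ 520 ∷ 260 ∷ []) 160) ◅◅ 160⇝5
reach-5d 6 _ = from-just (walk 56 (112 ∷ []) 16) ◅◅ 16⇝1
reach-5d 7 _ = from-just (walk 57 (114 ∷ 112 ∷ []) 16) ◅◅ 16⇝1
reach-5d 8 _ = from-just (walk 58 (54 ∷ 52 ∷ 26 ∷ []) 16) ◅◅ 16⇝1
reach-5d 9 _ = from-just (walk 59 (118 ∷ 114 ∷ 112 ∷ []) 16) ◅◅ 16⇝1
reach-5d (suc (suc (suc (suc (suc (suc (suc (suc (suc (suc _)))))))))) (s≤s (s≤s (s≤s (s≤s (s≤s (s≤s (s≤s (s≤s (s≤s (s≤s ()))))))))))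

reach-∷ʳ : ∀ {q} d → d < 10 → Connected q (rep q) → Connected (10 * q + d) (rep (10 * q + d))
reach-∷ʳ {q} d d<10 q⇝ =
  subst (Connected (10 * q + d)) (rep-cong (⇔.sym (Connected-pres-5∣ lifted))) (lifted ◅◅ base (rep-cases q))
  where
  lifted : Connected (10 * q + d) (10 * rep q + d)
  lifted = Connected-∷ʳ d<10 q⇝
  base : ∀ {c} → c ≡ 1 ⊎ c ≡ 5 → Connected (10 * c + d) (rep (10 * c + d))
  base (inj₁ refl) = reach-1d d d<10
  base (inj₂ refl) = reach-5d d d<10

reach : ∀ n → 0 < n → Connected n (rep n)
reach = <-rec (λ n → 0 < n → Connected n (rep n)) reach′
  where
  reach′ : ∀ n → (∀ {m} → m < n → 0 < m → Connected m (rep m)) → 0 < n → Connected n (rep n)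
  reach′ n rec n>0 with n <? 10
  ... | yes n<10 = reach-single-digit n n>0 n<10
  ... | no  n≮10 = subst (λ x → Connected x (rep x)) (sym (n≡10*[n/10]+n%10 n))
                     (reach-∷ʳ (n % 10) (m%n<n n 10) (rec q<n (m≥n⇒m/n>0 (≮⇒≥ n≮10))))
    where
    q<n : n / 10 < n
    q<n = m/n<m n 10 {{>-nonZero n>0}} (s≤s (s≤s z≤n))

5∣-below-10 : ∀ {r} → r < 10 → 5 ∣ r → r ≡ 0 ⊎ r ≡ 5
5∣-below-10 _    (divides 0 refl)             = inj₁ refl
5∣-below-10 _    (divides 1 refl)             = inj₂ refl
5∣-below-10 r<10 (divides (suc (suc q)) refl) = contradiction r<10 (≤⇒≯ (m≤m+n 10 (q * 5)))

EndsIn0or5⇔5∣ : ∀ n → EndsIn0or5 n ⇔ 5 ∣ n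
EndsIn0or5⇔5∣ n = ⇔.trans lastDigit (⇔.sym (subst (λ x → 5 ∣ x ⇔ 5 ∣ n % 10) (sym (n≡10*[n/10]+n%10 n)) dropPrefix))
  where
  lastDigit : (n % 10 ≡ 0 ⊎ n % 10 ≡ 5) ⇔ 5 ∣ n % 10
  lastDigit = mk⇔ (λ { (inj₁ r≡0) → subst (5 ∣_) (sym r≡0) (divides 0 refl)
                     ; (inj₂ r≡5) → subst (5 ∣_) (sym r≡5) (divides 1 refl) })
                  (5∣-below-10 (m%n<n n 10))
  dropPrefix : 5 ∣ 10 * (n / 10) + n % 10 ⇔ 5 ∣ n % 10
  dropPrefix = ∣m⇒∣m+n⇔∣n (∣m⇒∣m*n (n / 10) (divides 2 refl))

Edge-sym : Symmetric Edge
Edge-sym (n>0 , m>0 , n≢m , step) = m>0 , n>0 , n≢m ∘ sym , Sum.swap step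

theorem4 : (n m : ℕ) → 0 < n → 0 < m →
           Connected n m ⇔ (EndsIn0or5 n ⇔ EndsIn0or5 m)
theorem4 n m n>0 m>0 = mk⇔ ends-agree connect
  where
  ends-agree : Connected n m → EndsIn0or5 n ⇔ EndsIn0or5 m
  ends-agree n⇝m = ⇔.trans (EndsIn0or5⇔5∣ n) (⇔.trans (Connected-pres-5∣ n⇝m) (⇔.sym (EndsIn0or5⇔5∣ m)))
  connect : EndsIn0or5 n ⇔ EndsIn0or5 m → Connected n m
  connect n⇔m = reach n n>0 ◅◅ subst (λ r → Connected r m) same-rep (reverse Edge-sym (reach m m>0))
    where
    same-rep : rep m ≡ rep n
    same-rep = rep-cong (⇔.trans (⇔.sym (EndsIn0or5⇔5∣ m)) (⇔.trans (⇔.sym n⇔m) (EndsIn0or5⇔5∣ n)))
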